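{- Let $d,k,n$ be integers with $d\geq1$ and $2\leq k\leq n\leq d+1$, and let $P_n$ be the path with vertex set $\{1,\ldots,n\}$ and edges $\{i,i+1\}$. Then $\mathrm{gp}^k_d(P_n)=\mathrm{gp}^k(P_n)=\min(n,k-1)$.
   Context: For a graph $G$, a geodesic is a shortest path between two vertices; its length $\lambda(g)$ is its number of edges and $V(g)$ its vertex set. For $d\ge1$, $k\ge2$, $S\subseteq V(G)$ is a $k$-general $d$-position set in $G$ if every geodesic $g$ of $G$ with $|S\cap V(g)|\geq k$ has $\lambda(g)>d$; $\mathrm{gp}^k_d(G)$ is the largest cardinality of such a set. $\mathrm{gp}^k(G)$ is the largest cardinality of a set $S\subseteq V(G)$ such that no geodesic of $G$ contains $k$ or more vertices of $S$. -}

module Defs where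

open import Data.Nat using (ℕ; zero; suc; _≤_; _<_; _+_)
open import Data.Fin using (Fin; toℕ)
open import Data.Fin.Subset using (Subset; _∈_; ∣_∣)
open import Data.Fin.Subset.Properties using (_∈?_)
open import Data.List using (List; []; _∷_; length; filter)
open import Data.Product using (Σ; _×_)
open import Data.Sum using (_⊎_)
open import Relation.Binary.PropositionalEquality using (_≡_)

record Graph : Set₁ where
  field
    n   : ℕ
    Adj : Fin n → Fin n → Set

open Graph public

data Walk (G : Graph) : Fin (n G) → Fin (n G) → Set where
  [_]  : (v : Fin (n G)) → Walk G v v
  step : (u : Fin (n G)) {w v : Fin (n G)} → Adj G u w → Walk G w v → Walk G u v

len : {G : Graph} {u v : Fin (n G)} → Walk G u v → ℕ
len [ _ ]          = 0
len (step _ _ g)   = suc (len g)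

verts : {G : Graph} {u v : Fin (n G)} → Walk G u v → List (Fin (n G))
verts [ v ]          = v ∷ []
verts (step u _ g)   = u ∷ verts g

IsGeodesic : {G : Graph} {u v : Fin (n G)} → Walk G u v → Set
IsGeodesic {G} {u} {v} g = (g' : Walk G u v) → len g ≤ len g'

-- |S ∩ V(g)| (the vertices of a geodesic are distinct)
countIn : {G : Graph} {u v : Fin (n G)} → Subset (n G) → Walk G u v → ℕ
countIn S g = length (filter (λ x → x ∈? S) (verts g))

IsKGenDPos : (G : Graph) → ℕ → ℕ → Subset (n G) → Set
IsKGenDPos G k d S =
  (u v : Fin (n G)) (g : Walk G u v) → IsGeodesic g → k ≤ countIn S g → d < len g

IsKGenPos : (G : Graph) → ℕ → Subset (n G) → Set
IsKGenPos G k S =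
  (u v : Fin (n G)) (g : Walk G u v) → IsGeodesic g → countIn S g < k

IsMaxCard : (N : ℕ) → (Subset N → Set) → ℕ → Set
IsMaxCard N P m = Σ (Subset N) (λ S → P S × ∣ S ∣ ≡ m) × ((S : Subset N) → P S → ∣ S ∣ ≤ m)

GpKD≡ : (G : Graph) → ℕ → ℕ → ℕ → Set
GpKD≡ G k d m = IsMaxCard (n G) (IsKGenDPos G k d) m

GpK≡ : (G : Graph) → ℕ → ℕ → Set
GpK≡ G k m = IsMaxCard (n G) (IsKGenPos G k) m

-- The path P_n, vertices Fin n = {0,…,n-1} (standing for 1,…,n), edges {i,i+1}
PathGraph : ℕ → Graph
PathGraph m = record
  { n   = m
  ; Adj = λ i j → (toℕ j ≡ suc (toℕ i)) ⊎ (toℕ i ≡ suc (toℕ j)) }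

-- Geodesics have distinct vertices, so every set of fewer than k vertices is
-- in k-general (d-)position. Conversely the whole path P_n is a geodesic of
-- length n - 1 ≤ d through every vertex, so a set of k or more vertices
-- violates both conditions on it.
module Submission where

open import Defs
open import Data.Nat using (ℕ; zero; suc; _≤_; _<_; _+_; _∸_; _⊓_; z≤n; s≤s; s≤s⁻¹; _≤?_)
open import Data.Nat.Properties
open import Data.Bool using (Bool)
open import Data.Fin using (Fin; toℕ; fromℕ)
import Data.Fin as Fin
open import Data.Fin.Properties using (toℕ-fromℕ)
open import Data.Fin.Subset using (Subset; inside; outside; ∣_∣; ⊥; _-_) renaming (_∈_ to _∈ₛ_)
open import Data.Fin.Subset.Properties using (_∈?_; ∣⊥∣≡0; x∈p∧x≢y⇒x∈p-y; x∈p⇒∣p-x∣<∣p∣)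
open import Data.Vec using ([]; _∷_)
open import Data.List using (List; []; _∷_; length; filter; map; tabulate; allFin)
open import Data.List.Properties using (map-tabulate)
open import Data.List.Membership.Propositional using () renaming (_∈_ to _∈ₗ_)
open import Data.List.Relation.Unary.Any using (here; there)
open import Data.List.Relation.Unary.All as All using (All; []; _∷_)
open import Data.List.Relation.Unary.All.Properties using (¬Any⇒All¬; all-filter)
open import Data.List.Relation.Unary.Unique.Propositional using (Unique)
open import Data.List.Relation.Unary.AllPairs using ([]; _∷_)
import Data.List.Relation.Unary.Unique.Propositional.Properties as Unique
open import Data.Product using (Σ; _×_; _,_)
open import Data.Sum using (inj₁; inj₂)
import Data.Sum as Sum
open import Relation.Nullary using (¬_; yes; no; contradiction)
open import Function using (_∘′_)
open import Relation.Binary.PropositionalEquality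

count : ∀ {N} → Subset N → List (Fin N) → ℕ
count S xs = length (filter (_∈? S) xs)

length≤∣S∣ : ∀ {N} {S : Subset N} {xs : List (Fin N)} →
  Unique xs → All (_∈ₛ S) xs → length xs ≤ ∣ S ∣
length≤∣S∣ [] [] = z≤n
length≤∣S∣ {S = S} {x ∷ xs} (x≢xs ∷ unique) (x∈S ∷ xs⊆S) =
  ≤-trans (s≤s (length≤∣S∣ unique xs⊆S-x)) (x∈p⇒∣p-x∣<∣p∣ x∈S)
  where
  xs⊆S-x : All (_∈ₛ S - x) xs
  xs⊆S-x = All.zipWith (λ (y∈S , x≢y) → x∈p∧x≢y⇒x∈p-y y∈S (x≢y ∘′ sym)) (xs⊆S , x≢xs)

count≤∣S∣ : ∀ {N} (S : Subset N) {xs : List (Fin N)} → Unique xs → count S xs ≤ ∣ S ∣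
count≤∣S∣ S {xs} unique =
  length≤∣S∣ (Unique.filter⁺ (_∈? S) unique) (all-filter (_∈? S) xs)

count-map-suc : ∀ {N} (b : Bool) (S : Subset N) (xs : List (Fin N)) →
  count (b ∷ S) (map Fin.suc xs) ≡ count S xs
count-map-suc b S []       = refl
count-map-suc b S (x ∷ xs) with x ∈? S
... | yes _ = cong suc (count-map-suc b S xs)
... | no  _ = count-map-suc b S xs

count-tabulate-suc : ∀ {N} (b : Bool) (S : Subset N) →
  count (b ∷ S) (tabulate Fin.suc) ≡ count S (allFin N)
count-tabulate-suc {N} b S =
  trans (cong (count (b ∷ S)) (sym (map-tabulate (λ i → i) Fin.suc)))
        (count-map-suc b S (allFin N))

count-allFin : ∀ {N} (S : Subset N) → count S (allFin N) ≡ ∣ S ∣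
count-allFin []            = refl
count-allFin (inside ∷ S)  = cong suc (trans (count-tabulate-suc inside S) (count-allFin S))
count-allFin (outside ∷ S) = trans (count-tabulate-suc outside S) (count-allFin S)

firstOf : ∀ N → ℕ → Subset N
firstOf _       zero    = ⊥
firstOf zero    (suc _) = ⊥
firstOf (suc N) (suc m) = inside ∷ firstOf N m

∣firstOf∣ : ∀ {N m} → m ≤ N → ∣ firstOf N m ∣ ≡ m
∣firstOf∣ {N} z≤n   = ∣⊥∣≡0 N
∣firstOf∣ (s≤s m≤N) = cong suc (∣firstOf∣ m≤N)

size≤-characterises-IsMaxCard : ∀ {N m} {P : Subset N → Set} → m ≤ N →
  (∀ {S} → ∣ S ∣ ≤ m → P S) → (∀ {S} → P S → ∣ S ∣ ≤ m) → IsMaxCard N P m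
size≤-characterises-IsMaxCard {m = m} m≤N small⇒P P⇒small =
  (firstOf _ m , small⇒P (≤-reflexive (∣firstOf∣ m≤N)) , ∣firstOf∣ m≤N) , λ _ → P⇒small

module _ {G : Graph} where

  suffix : ∀ {u v x} (g : Walk G u v) → x ∈ₗ verts g → Σ (Walk G x v) λ h → len h ≤ len g
  suffix [ v ]        (here refl) = [ v ] , ≤-refl
  suffix (step u a g) (here refl) = step u a g , ≤-refl
  suffix (step u a g) (there x∈g) with suffix g x∈g
  ... | h , h≤g = h , m≤n⇒m≤1+n h≤g

  geodesic-unique : ∀ {u v} (g : Walk G u v) → IsGeodesic g → Unique (verts g)
  geodesic-unique [ v ]        _   = [] ∷ []
  geodesic-unique (step u a g) geo =
    ¬Any⇒All¬ (verts g) u∉g ∷ geodesic-unique g (λ g′ → s≤s⁻¹ (geo (step u a g′)))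
    where
    u∉g : ¬ u ∈ₗ verts g
    u∉g u∈g with suffix g u∈g
    ... | h , h≤g = <⇒≱ (s≤s h≤g) (geo h)

  countIn≤∣S∣ : ∀ {u v} (S : Subset (n G)) (g : Walk G u v) →
    IsGeodesic g → countIn S g ≤ ∣ S ∣
  countIn≤∣S∣ S g geo = count≤∣S∣ S (geodesic-unique g geo)

  ∣S∣<k⇒kGenPos : ∀ {k} {S : Subset (n G)} → ∣ S ∣ < k → IsKGenPos G k S
  ∣S∣<k⇒kGenPos ∣S∣<k _ _ g geo = ≤-<-trans (countIn≤∣S∣ _ g geo) ∣S∣<k

  ∣S∣<k⇒kGenDPos : ∀ {k d} {S : Subset (n G)} → ∣ S ∣ < k → IsKGenDPos G k d S
  ∣S∣<k⇒kGenDPos ∣S∣<k u v g geo k≤count =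
    contradiction k≤count (<⇒≱ (∣S∣<k⇒kGenPos ∣S∣<k u v g geo))

  -- Equivalently: the walk passes through every vertex exactly once.
  Spanning : ∀ {u v} → Walk G u v → Set
  Spanning g = (S : Subset (n G)) → countIn S g ≡ ∣ S ∣

  module _ {u v} {g : Walk G u v} (geo : IsGeodesic g) (spanning : Spanning g) where

    kGenPos⇒∣S∣<k : ∀ {k} {S : Subset (n G)} → IsKGenPos G k S → ∣ S ∣ < k
    kGenPos⇒∣S∣<k {S = S} pos = subst (_< _) (spanning S) (pos u v g geo)

    kGenDPos⇒∣S∣<k : ∀ {k d} {S : Subset (n G)} → len g ≤ d → IsKGenDPos G k d S → ∣ S ∣ < k
    kGenDPos⇒∣S∣<k {k} {S = S} g≤d dpos with k ≤? ∣ S ∣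
    ... | no  k≰S = ≰⇒> k≰S
    ... | yes k≤S =
      contradiction g≤d (<⇒≱ (dpos u v g geo (subst (k ≤_) (sym (spanning S)) k≤S)))

    gp≡ : ∀ {k} → k ≤ n G → GpK≡ G (suc k) k
    gp≡ k≤n = size≤-characterises-IsMaxCard k≤n (∣S∣<k⇒kGenPos ∘′ s≤s) (s≤s⁻¹ ∘′ kGenPos⇒∣S∣<k)

    gpD≡ : ∀ {k d} → k ≤ n G → len g ≤ d → GpKD≡ G (suc k) d k
    gpD≡ k≤n g≤d =
      size≤-characterises-IsMaxCard k≤n (∣S∣<k⇒kGenDPos ∘′ s≤s) (s≤s⁻¹ ∘′ kGenDPos⇒∣S∣<k g≤d)

toℕ-adjacent : ∀ {N} {u w : Fin N} → Adj (PathGraph N) u w → toℕ w ≤ suc (toℕ u)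
toℕ-adjacent (inj₁ w≡1+u) = ≤-reflexive w≡1+u
toℕ-adjacent (inj₂ u≡1+w) = m≤n⇒m≤1+n (<⇒≤ (≤-reflexive (sym u≡1+w)))

toℕ≤toℕ+len : ∀ {N} {u v : Fin N} (g : Walk (PathGraph N) u v) → toℕ v ≤ toℕ u + len g
toℕ≤toℕ+len {u = u} [ _ ] = ≤-reflexive (sym (+-identityʳ (toℕ u)))
toℕ≤toℕ+len {u = u} (step _ u~w g) = begin
  _                       ≤⟨ toℕ≤toℕ+len g ⟩
  _ + len g               ≤⟨ +-monoˡ-≤ (len g) (toℕ-adjacent u~w) ⟩
  suc (toℕ u) + len g     ≡⟨ +-suc (toℕ u) (len g) ⟨
  toℕ u + suc (len g)     ∎
  where open ≤-Reasoning

sucWalk : ∀ {N} {u v : Fin N} →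
  Walk (PathGraph N) u v → Walk (PathGraph (suc N)) (Fin.suc u) (Fin.suc v)
sucWalk [ v ]          = [ Fin.suc v ]
sucWalk (step u u~w g) = step (Fin.suc u) (Sum.map (cong suc) (cong suc) u~w) (sucWalk g)

len-sucWalk : ∀ {N} {u v : Fin N} (g : Walk (PathGraph N) u v) → len (sucWalk g) ≡ len g
len-sucWalk [ _ ]        = refl
len-sucWalk (step _ _ g) = cong suc (len-sucWalk g)

verts-sucWalk : ∀ {N} {u v : Fin N} (g : Walk (PathGraph N) u v) →
  verts (sucWalk g) ≡ map Fin.suc (verts g)
verts-sucWalk [ _ ]        = refl
verts-sucWalk (step u _ g) = cong (Fin.suc u ∷_) (verts-sucWalk g)

sweep : ∀ m → Walk (PathGraph (suc m)) Fin.zero (fromℕ m)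
sweep zero    = [ Fin.zero ]
sweep (suc m) = step Fin.zero (inj₁ refl) (sucWalk (sweep m))

len-sweep : ∀ m → len (sweep m) ≡ m
len-sweep zero    = refl
len-sweep (suc m) = cong suc (trans (len-sucWalk (sweep m)) (len-sweep m))

verts-sweep : ∀ m → verts (sweep m) ≡ allFin (suc m)
verts-sweep zero    = refl
verts-sweep (suc m) = cong (Fin.zero ∷_) (begin
  verts (sucWalk (sweep m))           ≡⟨ verts-sucWalk (sweep m) ⟩
  map Fin.suc (verts (sweep m))       ≡⟨ cong (map Fin.suc) (verts-sweep m) ⟩
  map Fin.suc (allFin (suc m))        ≡⟨ map-tabulate (λ i → i) Fin.suc ⟩
  tabulate Fin.suc                    ∎)
  where open ≡-Reasoning

sweep-geodesic : ∀ m → IsGeodesic (sweep m)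
sweep-geodesic m g = begin
  len (sweep m)       ≡⟨ len-sweep m ⟩
  m                   ≡⟨ toℕ-fromℕ m ⟨
  toℕ (fromℕ m)       ≤⟨ toℕ≤toℕ+len g ⟩
  len g               ∎
  where open ≤-Reasoning

sweep-spanning : ∀ m → Spanning (sweep m)
sweep-spanning m S = trans (cong (count S) (verts-sweep m)) (count-allFin S)

lemma3p2 : (d k n : ℕ) → 1 ≤ d → 2 ≤ k → k ≤ n → n ≤ d + 1 →
    GpKD≡ (PathGraph n) k d (n ⊓ (k ∸ 1)) × GpK≡ (PathGraph n) k (n ⊓ (k ∸ 1))
lemma3p2 d (suc k) (suc m) _ _ k<n n≤d+1 rewrite m≥n⇒m⊓n≡n (<⇒≤ k<n) =
    gpD≡ (sweep-geodesic m) (sweep-spanning m) (<⇒≤ k<n) sweep≤d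
  , gp≡  (sweep-geodesic m) (sweep-spanning m) (<⇒≤ k<n)
  where
  sweep≤d : len (sweep m) ≤ d
  sweep≤d = subst (_≤ d) (sym (len-sweep m)) (s≤s⁻¹ (subst (suc m ≤_) (+-comm d 1) n≤d+1))
lemma3p2 _ (suc k) zero _ _ ()
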